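{- The following weakening rules are admissible in $\mathsf{G}(\mathbf{KT_n^+})$: for all finite multisets $\Sigma$ (of outmost-boxed formulas), $\Gamma,\Delta$, every formula $A$ and every $i\in\mathsf{Agt}$, if $\mathsf{G}(\mathbf{KT_n^+})\vdash\Sigma|\Gamma\Rightarrow\Delta$ then $\mathsf{G}(\mathbf{KT_n^+})$ derives $\Sigma|\Gamma\Rightarrow\Delta,A$, $\Sigma|A,\Gamma\Rightarrow\Delta$, and $\Sigma,\Box_iA|\Gamma\Rightarrow\Delta$.
   Context: Formulas of $\mathcal{L}^1$ over a finite agent set $\mathsf{Agt}$ and countable $\mathsf{Prop}$: $A::=p\mid\bot\mid A\wedge A\mid A\vee A\mid A\rightarrow A\mid\neg A\mid\Box_i A$. Outmost-boxed formula: $\Box_jB$; $\Box_i\Gamma=\{\Box_iA:A\in\Gamma\}$. A T-sequent $\Sigma|\Gamma\Rightarrow\Delta$ consists of finite multisets with $\Sigma$ consisting of outmost-boxed formulas. $\mathsf{G}(\mathbf{KT_n^+})$: initial T-sequents $\Sigma|\Gamma,p\Rightarrow p,\Delta$ and $\Sigma|\bot,\Gamma\Rightarrow\Delta$; logical rules (with $\Sigma$ unchanged): $(R\wedge)$ $\Sigma|\Gamma\Rightarrow\Delta,A_1$ and $\Sigma|\Gamma\Rightarrow\Delta,A_2$ / $\Sigma|\Gamma\Rightarrow\Delta,A_1\wedge A_2$; $(L\wedge)$ $\Sigma|A_1,A_2,\Gamma\Rightarrow\Delta$ / $\Sigma|A_1\wedge A_2,\Gamma\Rightarrow\Delta$;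 $(R\vee)$ $\Sigma|\Gamma\Rightarrow\Delta,A_1,A_2$ / $\Sigma|\Gamma\Rightarrow\Delta,A_1\vee A_2$; $(L\vee)$ $\Sigma|A_1,\Gamma\Rightarrow\Delta$ and $\Sigma|A_2,\Gamma\Rightarrow\Delta$ / $\Sigma|A_1\vee A_2,\Gamma\Rightarrow\Delta$; $(R\rightarrow)$ $\Sigma|A_1,\Gamma\Rightarrow\Delta,A_2$ / $\Sigma|\Gamma\Rightarrow\Delta,A_1\rightarrow A_2$; $(L\rightarrow)$ $\Sigma|\Gamma\Rightarrow\Delta,A_1$ and $\Sigma|A_2,\Gamma\Rightarrow\Delta$ / $\Sigma|A_1\rightarrow A_2,\Gamma\Rightarrow\Delta$; $(R\neg)$ $\Sigma|A,\Gamma\Rightarrow\Delta$ / $\Sigma|\Gamma\Rightarrow\Delta,\neg A$; $(L\neg)$ $\Sigma|\Gamma\Rightarrow\Delta,A$ / $\Sigma|\neg A,\Gamma\Rightarrow\Delta$. Modal rules: $(\Box^+_{Kn})$: from $\emptyset|\Gamma\Rightarrow A$ infer $\Sigma,\Box_i\Gamma|\Pi\Rightarrow\Box_iA,\Omega$, where $\Sigma$ contains only formulas $\Box_jB$ with $j\neq i$, $\Pi$ only propositional variables and $\bot$, $\Omega$ only propositional variables, $\bot$, or outmost-boxed formulas; $(\Box^+_{Tn})$: from $\Box_iA,\Sigma|\Gamma,A\Rightarrow\Delta$ infer $\Sigma|\Gamma,\Box_iA\Rightarrow\Delta$. -}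

module Defs where

open import Data.Nat using (ℕ)
open import Data.Fin using (Fin)
open import Data.List using (List; []; _∷_; _++_; map)
open import Data.List.Relation.Unary.All using (All)
open import Data.List.Relation.Binary.Permutation.Propositional using (_↭_)
open import Data.Product using (_×_; _,_; proj₁)
open import Relation.Binary.PropositionalEquality using (_≢_)

data Fm (n : ℕ) : Set where
  var  : ℕ → Fm n
  ⊥'   : Fm n
  _∧'_ : Fm n → Fm n → Fm n
  _∨'_ : Fm n → Fm n → Fm n
  _⇒'_ : Fm n → Fm n → Fm n
  ¬'_  : Fm n → Fm n
  □    : Fin n → Fm n → Fm n

-- An outmost-boxed formula □_j B, represented by the pair (j , B).
-- The Σ part of a T-sequent is a (multi)set of such formulas.
Boxed : ℕ → Set
Boxed n = Fin n × Fm n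

data VarOrBot {n : ℕ} : Fm n → Set where
  isVar : ∀ p → VarOrBot (var p)
  isBot : VarOrBot ⊥'

data VarBotOrBoxed {n : ℕ} : Fm n → Set where
  isVar : ∀ p → VarBotOrBoxed (var p)
  isBot : VarBotOrBoxed ⊥'
  isBox : ∀ j B → VarBotOrBoxed (□ j B)

-- Multisets are lists; every rule conclusion is taken up to permutation (_↭_),
-- so that derivability is a property of the underlying multisets.
data ⊢_∣_⇒_ {n : ℕ} : List (Boxed n) → List (Fm n) → List (Fm n) → Set where
  ax   : ∀ {Σ Γ Δ Γ₀ Δ₀} p → Γ₀ ↭ var p ∷ Γ → Δ₀ ↭ var p ∷ Δ → ⊢ Σ ∣ Γ₀ ⇒ Δ₀
  ax⊥  : ∀ {Σ Γ Δ Γ₀} → Γ₀ ↭ ⊥' ∷ Γ → ⊢ Σ ∣ Γ₀ ⇒ Δ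
  R∧   : ∀ {Σ Γ Δ Δ₀ A₁ A₂} → ⊢ Σ ∣ Γ ⇒ (A₁ ∷ Δ) → ⊢ Σ ∣ Γ ⇒ (A₂ ∷ Δ)
         → Δ₀ ↭ (A₁ ∧' A₂) ∷ Δ → ⊢ Σ ∣ Γ ⇒ Δ₀
  L∧   : ∀ {Σ Γ Δ Γ₀ A₁ A₂} → ⊢ Σ ∣ (A₁ ∷ A₂ ∷ Γ) ⇒ Δ
         → Γ₀ ↭ (A₁ ∧' A₂) ∷ Γ → ⊢ Σ ∣ Γ₀ ⇒ Δ
  R∨   : ∀ {Σ Γ Δ Δ₀ A₁ A₂} → ⊢ Σ ∣ Γ ⇒ (A₁ ∷ A₂ ∷ Δ)
         → Δ₀ ↭ (A₁ ∨' A₂) ∷ Δ → ⊢ Σ ∣ Γ ⇒ Δ₀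
  L∨   : ∀ {Σ Γ Δ Γ₀ A₁ A₂} → ⊢ Σ ∣ (A₁ ∷ Γ) ⇒ Δ → ⊢ Σ ∣ (A₂ ∷ Γ) ⇒ Δ
         → Γ₀ ↭ (A₁ ∨' A₂) ∷ Γ → ⊢ Σ ∣ Γ₀ ⇒ Δ
  R⇒   : ∀ {Σ Γ Δ Δ₀ A₁ A₂} → ⊢ Σ ∣ (A₁ ∷ Γ) ⇒ (A₂ ∷ Δ)
         → Δ₀ ↭ (A₁ ⇒' A₂) ∷ Δ → ⊢ Σ ∣ Γ ⇒ Δ₀
  L⇒   : ∀ {Σ Γ Δ Γ₀ A₁ A₂} → ⊢ Σ ∣ Γ ⇒ (A₁ ∷ Δ) → ⊢ Σ ∣ (A₂ ∷ Γ) ⇒ Δ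
         → Γ₀ ↭ (A₁ ⇒' A₂) ∷ Γ → ⊢ Σ ∣ Γ₀ ⇒ Δ
  R¬   : ∀ {Σ Γ Δ Δ₀ A} → ⊢ Σ ∣ (A ∷ Γ) ⇒ Δ
         → Δ₀ ↭ (¬' A) ∷ Δ → ⊢ Σ ∣ Γ ⇒ Δ₀
  L¬   : ∀ {Σ Γ Δ Γ₀ A} → ⊢ Σ ∣ Γ ⇒ (A ∷ Δ)
         → Γ₀ ↭ (¬' A) ∷ Γ → ⊢ Σ ∣ Γ₀ ⇒ Δ
  □K   : ∀ {Σ Σ₀ Γ Π Ω Δ₀ A} (i : Fin n)
         → ⊢ [] ∣ Γ ⇒ (A ∷ [])
         → All (λ jB → proj₁ jB ≢ i) Σ
         → All VarOrBot Π
         → All VarBotOrBoxed Ω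
         → Σ₀ ↭ Σ ++ map (i ,_) Γ
         → Δ₀ ↭ □ i A ∷ Ω
         → ⊢ Σ₀ ∣ Π ⇒ Δ₀
  □T   : ∀ {Σ Σ₁ Γ Γ₀ Δ A} (i : Fin n)
         → ⊢ Σ₁ ∣ (A ∷ Γ) ⇒ Δ
         → Σ₁ ↭ (i , A) ∷ Σ
         → Γ₀ ↭ □ i A ∷ Γ
         → ⊢ Σ ∣ Γ₀ ⇒ Δ

{-# OPTIONS --safe #-}
-- Weakening by a formula that (□⁺_Kn) tolerates in its context (atoms, ⊥ and,
-- on the right, boxed formulas) is pushed up through a derivation.  Any other
-- formula is weakened in by its own introduction rule applied to weakenings by
-- its immediate subformulas; a boxed formula □ᵢA on the left is introduced by
-- (□⁺_Tn) from a Σ-weakening by □ᵢA, and that one needs, at each (□⁺_Kn) step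
-- of agent i, the left weakening by A of its premise.
module Submission where

open import Defs
open import Data.Nat using (ℕ)
open import Data.Fin using (Fin; _≟_)
open import Data.List using (List; []; _∷_; map)
open import Data.List.Relation.Unary.All using (_∷_)
open import Data.List.Relation.Binary.Permutation.Propositional
  using (_↭_; refl; prep; swap; trans; ↭-sym)
open import Data.List.Relation.Binary.Permutation.Propositional.Properties
  using (All-resp-↭; shift)
open import Data.Product using (_×_; _,_)
open import Relation.Nullary using (yes; no)
open import Relation.Binary.PropositionalEquality using (refl)

module _ {a} {A : Set a} where

  ↭-insert-second : ∀ {x y : A} {xs ys} → xs ↭ y ∷ ys → x ∷ xs ↭ y ∷ x ∷ ys
  ↭-insert-second {x} {y} p = trans (prep x p) (swap x y refl)

  ↭-swap-heads : ∀ {x y : A} {xs} → x ∷ y ∷ xs ↭ y ∷ x ∷ xs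
  ↭-swap-heads {x} {y} = swap x y refl

  ↭-rotate₃ : ∀ {x y z : A} {xs} → x ∷ y ∷ z ∷ xs ↭ z ∷ x ∷ y ∷ xs
  ↭-rotate₃ {x} {y} {z} = trans (prep x (swap y z refl)) (swap x z refl)

module _ {n : ℕ} where

  exchange : ∀ {Σ : List (Boxed n)} {Γ Γ′ Δ Δ′} →
             Γ′ ↭ Γ → Δ′ ↭ Δ → ⊢ Σ ∣ Γ ⇒ Δ → ⊢ Σ ∣ Γ′ ⇒ Δ′
  exchange γ δ (ax p q r)         = ax p (trans γ q) (trans δ r)
  exchange γ δ (ax⊥ q)            = ax⊥ (trans γ q)
  exchange γ δ (R∧ d e q)         = R∧ (exchange γ refl d) (exchange γ refl e) (trans δ q)
  exchange γ δ (L∧ d q)           = L∧ (exchange refl δ d) (trans γ q)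
  exchange γ δ (R∨ d q)           = R∨ (exchange γ refl d) (trans δ q)
  exchange γ δ (L∨ d e q)         = L∨ (exchange refl δ d) (exchange refl δ e) (trans γ q)
  exchange γ δ (R⇒ d q)           = R⇒ (exchange (prep _ γ) refl d) (trans δ q)
  exchange γ δ (L⇒ d e q)         = L⇒ (exchange refl (prep _ δ) d) (exchange refl δ e) (trans γ q)
  exchange γ δ (R¬ d q)           = R¬ (exchange (prep _ γ) refl d) (trans δ q)
  exchange γ δ (L¬ d q)           = L¬ (exchange refl (prep _ δ) d) (trans γ q)
  exchange γ δ (□K i d σ π ω s q) = □K i d σ (All-resp-↭ (↭-sym γ) π) ω s (trans δ q)
  exchange γ δ (□T i d s q)       = □T i (exchange refl δ d) s (trans γ q)

  exchangeˡ : ∀ {Σ : List (Boxed n)} {Γ Γ′ Δ} → Γ′ ↭ Γ → ⊢ Σ ∣ Γ ⇒ Δ → ⊢ Σ ∣ Γ′ ⇒ Δ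
  exchangeˡ γ = exchange γ refl

  exchangeʳ : ∀ {Σ : List (Boxed n)} {Γ Δ Δ′} → Δ′ ↭ Δ → ⊢ Σ ∣ Γ ⇒ Δ → ⊢ Σ ∣ Γ ⇒ Δ′
  exchangeʳ = exchange refl

  weakenʳ-VarBotOrBoxed : ∀ {A : Fm n} {Σ Γ Δ} →
                          VarBotOrBoxed A → ⊢ Σ ∣ Γ ⇒ Δ → ⊢ Σ ∣ Γ ⇒ (A ∷ Δ)
  weakenʳ-VarBotOrBoxed v (ax p q r)         = ax p q (↭-insert-second r)
  weakenʳ-VarBotOrBoxed v (ax⊥ q)            = ax⊥ q
  weakenʳ-VarBotOrBoxed v (R∧ d e q)         =
    R∧ (exchangeʳ ↭-swap-heads (weakenʳ-VarBotOrBoxed v d))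
       (exchangeʳ ↭-swap-heads (weakenʳ-VarBotOrBoxed v e)) (↭-insert-second q)
  weakenʳ-VarBotOrBoxed v (L∧ d q)           = L∧ (weakenʳ-VarBotOrBoxed v d) q
  weakenʳ-VarBotOrBoxed v (R∨ d q)           =
    R∨ (exchangeʳ ↭-rotate₃ (weakenʳ-VarBotOrBoxed v d)) (↭-insert-second q)
  weakenʳ-VarBotOrBoxed v (L∨ d e q)         =
    L∨ (weakenʳ-VarBotOrBoxed v d) (weakenʳ-VarBotOrBoxed v e) q
  weakenʳ-VarBotOrBoxed v (R⇒ d q)           =
    R⇒ (exchangeʳ ↭-swap-heads (weakenʳ-VarBotOrBoxed v d)) (↭-insert-second q)
  weakenʳ-VarBotOrBoxed v (L⇒ d e q)         =
    L⇒ (exchangeʳ ↭-swap-heads (weakenʳ-VarBotOrBoxed v d)) (weakenʳ-VarBotOrBoxed v e) q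
  weakenʳ-VarBotOrBoxed v (R¬ d q)           = R¬ (weakenʳ-VarBotOrBoxed v d) (↭-insert-second q)
  weakenʳ-VarBotOrBoxed v (L¬ d q) =
    L¬ (exchangeʳ ↭-swap-heads (weakenʳ-VarBotOrBoxed v d)) q
  weakenʳ-VarBotOrBoxed v (□K i d σ π ω s q) = □K i d σ π (v ∷ ω) s (↭-insert-second q)
  weakenʳ-VarBotOrBoxed v (□T i d s q)       = □T i (weakenʳ-VarBotOrBoxed v d) s q

  weakenˡ-VarOrBot : ∀ {A : Fm n} {Σ Γ Δ} → VarOrBot A → ⊢ Σ ∣ Γ ⇒ Δ → ⊢ Σ ∣ (A ∷ Γ) ⇒ Δ
  weakenˡ-VarOrBot v (ax p q r)         = ax p (↭-insert-second q) r
  weakenˡ-VarOrBot v (ax⊥ q)            = ax⊥ (↭-insert-second q)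
  weakenˡ-VarOrBot v (R∧ d e q)         = R∧ (weakenˡ-VarOrBot v d) (weakenˡ-VarOrBot v e) q
  weakenˡ-VarOrBot v (L∧ d q)           =
    L∧ (exchangeˡ ↭-rotate₃ (weakenˡ-VarOrBot v d)) (↭-insert-second q)
  weakenˡ-VarOrBot v (R∨ d q)           = R∨ (weakenˡ-VarOrBot v d) q
  weakenˡ-VarOrBot v (L∨ d e q)         =
    L∨ (exchangeˡ ↭-swap-heads (weakenˡ-VarOrBot v d))
       (exchangeˡ ↭-swap-heads (weakenˡ-VarOrBot v e)) (↭-insert-second q)
  weakenˡ-VarOrBot v (R⇒ d q)           = R⇒ (exchangeˡ ↭-swap-heads (weakenˡ-VarOrBot v d)) q
  weakenˡ-VarOrBot v (L⇒ d e q)         =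
    L⇒ (weakenˡ-VarOrBot v d) (exchangeˡ ↭-swap-heads (weakenˡ-VarOrBot v e)) (↭-insert-second q)
  weakenˡ-VarOrBot v (R¬ d q)           = R¬ (exchangeˡ ↭-swap-heads (weakenˡ-VarOrBot v d)) q
  weakenˡ-VarOrBot v (L¬ d q)           = L¬ (weakenˡ-VarOrBot v d) (↭-insert-second q)
  weakenˡ-VarOrBot v (□K i d σ π ω s q) = □K i d σ (v ∷ π) ω s q
  weakenˡ-VarOrBot v (□T i d s q)       =
    □T i (exchangeˡ ↭-swap-heads (weakenˡ-VarOrBot v d)) s (↭-insert-second q)

  weakenᴮ : ∀ {A : Fm n} (i : Fin n) →
            (∀ {Γ Δ} → ⊢ [] ∣ Γ ⇒ Δ → ⊢ [] ∣ (A ∷ Γ) ⇒ Δ) →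
            ∀ {Σ Γ Δ} → ⊢ Σ ∣ Γ ⇒ Δ → ⊢ ((i , A) ∷ Σ) ∣ Γ ⇒ Δ
  weakenᴮ i wA (ax p q r)   = ax p q r
  weakenᴮ i wA (ax⊥ q)      = ax⊥ q
  weakenᴮ i wA (R∧ d e q)   = R∧ (weakenᴮ i wA d) (weakenᴮ i wA e) q
  weakenᴮ i wA (L∧ d q)     = L∧ (weakenᴮ i wA d) q
  weakenᴮ i wA (R∨ d q)     = R∨ (weakenᴮ i wA d) q
  weakenᴮ i wA (L∨ d e q)   = L∨ (weakenᴮ i wA d) (weakenᴮ i wA e) q
  weakenᴮ i wA (R⇒ d q)     = R⇒ (weakenᴮ i wA d) q
  weakenᴮ i wA (L⇒ d e q)   = L⇒ (weakenᴮ i wA d) (weakenᴮ i wA e) q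
  weakenᴮ i wA (R¬ d q)     = R¬ (weakenᴮ i wA d) q
  weakenᴮ i wA (L¬ d q)     = L¬ (weakenᴮ i wA d) q
  weakenᴮ i wA (□T j d s q) = □T j (weakenᴮ i wA d) (↭-insert-second s) q
  weakenᴮ i wA (□K {Σ = Σ} {Γ = Γ} j d σ π ω s q) with i ≟ j
  -- □ᵢA cannot stay among the side formulas of agent-j boxes; it joins □ⱼΓ instead.
  ... | yes refl = □K j (wA d) σ π ω (trans (prep _ s) (↭-sym (shift _ Σ (map (j ,_) Γ)))) q
  ... | no i≢j   = □K j d (i≢j ∷ σ) π ω (prep _ s) q

  mutual
    weakenʳ : ∀ (A : Fm n) {Σ Γ Δ} → ⊢ Σ ∣ Γ ⇒ Δ → ⊢ Σ ∣ Γ ⇒ (A ∷ Δ)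
    weakenʳ (var p)  d = weakenʳ-VarBotOrBoxed (isVar p) d
    weakenʳ ⊥'       d = weakenʳ-VarBotOrBoxed isBot d
    weakenʳ (B ∧' C) d = R∧ (weakenʳ B d) (weakenʳ C d) refl
    weakenʳ (B ∨' C) d = R∨ (weakenʳ B (weakenʳ C d)) refl
    weakenʳ (B ⇒' C) d = R⇒ (weakenʳ C (weakenˡ B d)) refl
    weakenʳ (¬' B)   d = R¬ (weakenˡ B d) refl
    weakenʳ (□ j B)  d = weakenʳ-VarBotOrBoxed (isBox j B) d

    weakenˡ : ∀ (A : Fm n) {Σ Γ Δ} → ⊢ Σ ∣ Γ ⇒ Δ → ⊢ Σ ∣ (A ∷ Γ) ⇒ Δ
    weakenˡ (var p)  d = weakenˡ-VarOrBot (isVar p) d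
    weakenˡ ⊥'       d = weakenˡ-VarOrBot isBot d
    weakenˡ (B ∧' C) d = L∧ (weakenˡ B (weakenˡ C d)) refl
    weakenˡ (B ∨' C) d = L∨ (weakenˡ B d) (weakenˡ C d) refl
    weakenˡ (B ⇒' C) d = L⇒ (weakenʳ B d) (weakenˡ C d) refl
    weakenˡ (¬' B)   d = L¬ (weakenʳ B d) refl
    weakenˡ (□ j B)  d = □T j (weakenᴮ j (weakenˡ B) (weakenˡ B d)) refl refl

proposition4p7 : ∀ {n : ℕ} (Σ : List (Boxed n)) (Γ Δ : List (Fm n)) (A : Fm n) (i : Fin n)
    → ⊢ Σ ∣ Γ ⇒ Δ
    → (⊢ Σ ∣ Γ ⇒ (A ∷ Δ)) × (⊢ Σ ∣ (A ∷ Γ) ⇒ Δ) × (⊢ ((i , A) ∷ Σ) ∣ Γ ⇒ Δ)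
proposition4p7 Σ Γ Δ A i d = weakenʳ A d , weakenˡ A d , weakenᴮ i (weakenˡ A) d
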